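{- Let $\mathcal{S}$ be an action-based randomization mechanism and $x,x'\in\mathcal{X}$. Then $x\equiv x'$ if and only if $p_a(\cdot|x)=p_a(\cdot|x')$ for each $a\in Act$. In other words, $\equiv$ equals $\bigcap_{a\in Act}\equiv_a$, where $x\equiv_a x'$ iff $p_a(\cdot|x)=p_a(\cdot|x')$.
   Context: An action-based randomization mechanism is a 4-tuple $\mathcal{S}=(\mathcal{X},\mathcal{Y},Act,\{M_a:a\in Act\})$ where $\mathcal{X},\mathcal{Y},Act$ are finite nonempty sets and each $M_a$ is a stochastic $|\mathcal{X}|\times|\mathcal{Y}|$ matrix with entries $p_a(y|x)$; $p_a(\cdot|x)$ is the row $x$ of $M_a$. A strategy is a partial function $\sigma:\mathcal{Y}^*\to Act$ with nonempty prefix-closed domain; finite if its domain is finite. For a finite strategy $\sigma$ and $x\in\mathcal{X}$, $p_\sigma(\cdot|x)$ is the distribution on $\mathcal{Y}^*$ given by $p_\sigma(\varepsilon|x)=0$ and $p_\sigma(y_1\cdots y_{j+1}|x)=\prod_{i=1}^{j+1}p_{a_i}(y_i|x)$ with $a_i=\sigma(y_1\cdots y_{i-1})$ if $y_1\cdots y_j\in\mathrm{dom}(\sigma)$ and $y_1\cdots y_{j+1}\notin\mathrm{dom}(\sigma)$, and $0$ otherwise. Indistinguishability: $x\equiv x'$ iff for each finite strategy $\sigma$, $p_\sigma(\cdot|x)=p_\sigma(\cdot|x')$. -}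

module Defs where

open import Level using (Level; _⊔_)
open import Data.Nat using (ℕ; zero; suc)
open import Data.Fin using (Fin)
import Data.Fin as Fin
open import Data.List using (List; []; _∷_)
open import Data.Maybe using (Maybe; just; nothing)
open import Algebra.Bundles using (CommutativeSemiring)

-- Probabilities live in an arbitrary commutative semiring R (the reals being
-- the intended instance; agda-stdlib has no reals).
module _ {c ℓ : Level} (R : CommutativeSemiring c ℓ) where
  open CommutativeSemiring R

  sumFin : (n : ℕ) → (Fin n → Carrier) → Carrier
  sumFin zero    f = 0#
  sumFin (suc n) f = f Fin.zero + sumFin n (λ i → f (Fin.suc i))

  -- An action-based randomization mechanism with |X| = nX, |Y| = nY, |Act| = nA.
  -- prob a x y  is  p_a(y|x), the (x,y) entry of the matrix M_a.
  record Mechanism (nX nY nA : ℕ) : Set (c ⊔ ℓ) where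
    field
      prob       : Fin nA → Fin nX → Fin nY → Carrier
      -- each M_a is stochastic: rows sum to 1
      -- (nonnegativity of entries is not required)
      stochastic : ∀ a x → sumFin nY (prob a x) ≈ 1#

-- A finite strategy: a nonempty, finite, prefix-closed domain in Y* together
-- with an action at each point of the domain, i.e. a finite tree.
-- node a ch : the root ε is in the domain with σ(ε) = a; for each y,
-- ch y = just τ means y is in the domain and σ(y w) = τ(w),
-- ch y = nothing means y (and hence every y w) is outside the domain.
data Strategy (nY nA : ℕ) : Set where
  node : Fin nA → (Fin nY → Maybe (Strategy nY nA)) → Strategy nY nA

module _ {c ℓ : Level} (R : CommutativeSemiring c ℓ) {nX nY nA : ℕ}
         (S : Mechanism R nX nY nA) where
  open CommutativeSemiring R
  open Mechanism S

  pσ : Strategy nY nA → Fin nX → List (Fin nY) → Carrier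
  pσ σ            x []      = 0#
  pσ (node a ch)  x (y ∷ w) = prob a x y * rest (ch y) w
    where
      rest : Maybe (Strategy nY nA) → List (Fin nY) → Carrier
      rest nothing  []      = 1#
      rest nothing  (_ ∷ _) = 0#
      rest (just τ) w'      = pσ τ x w'

  Indist : Fin nX → Fin nX → Set ℓ
  Indist x x' = ∀ (σ : Strategy nY nA) (w : List (Fin nY)) → pσ σ x w ≈ pσ σ x' w

  IndistAct : Fin nA → Fin nX → Fin nX → Set ℓ
  IndistAct a x x' = ∀ (y : Fin nY) → prob a x y ≈ prob a x' y

-- The strategy that plays a once and stops observes exactly the row p_a(·|x),
-- so indistinguishability forces equal rows. Conversely p_σ(y₁⋯yₖ|x) is a
-- product of entries p_aᵢ(yᵢ|x) along a path of σ times a constant 0 or 1,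
-- so equal rows for every action give equal probabilities, by induction on σ.
module Submission where

open import Defs
open import Level using (Level)
open import Data.Nat using (ℕ; suc)
open import Data.Fin using (Fin)
open import Data.List using ([]; _∷_)
open import Data.Maybe using (just; nothing)
open import Function.Bundles using (_⇔_; mk⇔)
open import Algebra.Bundles using (CommutativeSemiring)

module _ {c ℓ : Level} (R : CommutativeSemiring c ℓ) {nX nY nA : ℕ}
         (S : Mechanism R nX nY nA) where
  open CommutativeSemiring R
  open Mechanism S

  stopAfter : Fin nA → Strategy nY nA
  stopAfter a = node a (λ _ → nothing)

  pσ-stopAfter : ∀ a x y → pσ R S (stopAfter a) x (y ∷ []) ≈ prob a x y
  pσ-stopAfter a x y = *-identityʳ (prob a x y)

  indist⇒indistAct : ∀ {x x'} → Indist R S x x' → ∀ a → IndistAct R S a x x'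
  indist⇒indistAct {x} {x'} x≡x' a y = begin
    prob a x y                          ≈⟨ pσ-stopAfter a x y ⟨
    pσ R S (stopAfter a) x (y ∷ [])     ≈⟨ x≡x' (stopAfter a) (y ∷ []) ⟩
    pσ R S (stopAfter a) x' (y ∷ [])    ≈⟨ pσ-stopAfter a x' y ⟩
    prob a x' y                         ∎
    where open import Relation.Binary.Reasoning.Setoid setoid

  indistAct⇒indist : ∀ {x x'} → (∀ a → IndistAct R S a x x') → Indist R S x x'
  indistAct⇒indist rows σ           []      = refl
  indistAct⇒indist rows (node a ch) (y ∷ w) with ch y
  ... | just τ = *-cong (rows a y) (indistAct⇒indist rows τ w)
  indistAct⇒indist rows (node a ch) (y ∷ [])    | nothing = *-cong (rows a y) refl
  indistAct⇒indist rows (node a ch) (y ∷ _ ∷ _) | nothing = *-cong (rows a y) refl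

lemma5p2 : ∀ {c ℓ : Level} (R : CommutativeSemiring c ℓ) {nX nY nA : ℕ}
             (S : Mechanism R (suc nX) (suc nY) (suc nA))
             (x x' : Fin (suc nX)) →
             Indist R S x x' ⇔ (∀ (a : Fin (suc nA)) → IndistAct R S a x x')
lemma5p2 R S x x' = mk⇔ (indist⇒indistAct R S) (indistAct⇒indist R S)
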